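{- Let $t \in \mathbb{N}$ be squarefree. The set of primitive Pythagorean triples $(a,b,c)$ with $a<b<c$ whose area $ab/2$ has squarefree part equal to $t$ is in bijection with the set of pairs $(m,n)$ of coprime positive integers for which both $m^2 + tn^2$ and $m^2 - tn^2$ are squares of integers. The mutually inverse bijections are \[ (a,b,c) \mapsto \big(c, \sqrt{2ab/t}\big) = (m,n), \] \[ (m,n) \mapsto \left( \tfrac{\sqrt{m^2+tn^2}-\sqrt{m^2-tn^2}}{2},\ \tfrac{\sqrt{m^2+tn^2}+\sqrt{m^2-tn^2}}{2},\ m \right) = (a,b,c). \]
   Context: A primitive Pythagorean triple is a triple $(a,b,c)$ of pairwise coprime positive integers with $a^2+b^2=c^2$. The squarefree part of a positive integer $N$ is the unique squarefree positive integer $s$ such that $N = s k^2$ for some positive integer $k$. -}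

module Defs where

open import Data.Nat using (ℕ; _+_; _*_; _/_; _<_)
open import Data.Nat.Divisibility using (_∣_)
open import Data.Nat.Coprimality using (Coprime)
open import Data.Product using (Σ; ∃; _×_)
open import Relation.Binary.PropositionalEquality using (_≡_)

-- s is squarefree: no square of an integer > 1 divides s.
-- (0 is not squarefree, since 2*2 ∣ 0.)
Squarefree : ℕ → Set
Squarefree s = ∀ p → p * p ∣ s → p ≡ 1

SquarefreePart : ℕ → ℕ → Set
SquarefreePart N s = Squarefree s × ∃ λ k → 0 < k × N ≡ s * (k * k)

PrimitivePythagorean : ℕ → ℕ → ℕ → Set
PrimitivePythagorean a b c =
  0 < a × 0 < b × 0 < c ×
  Coprime a b × Coprime b c × Coprime a c ×
  a * a + b * b ≡ c * c

TripleSet : ℕ → ℕ → ℕ → ℕ → Set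
TripleSet t a b c =
  PrimitivePythagorean a b c × a < b × b < c × SquarefreePart ((a * b) / 2) t

-- x is the square of an integer (an integer square root can be taken ≥ 0)
IsSquare : ℕ → Set
IsSquare x = ∃ λ j → j * j ≡ x

-- The second set: coprime positive (m,n) with m²+tn² and m²-tn² squares of
-- integers.  "m²-tn² = k² for an integer k" is written  k² + tn² = m²
-- (which in particular forces m² ≥ tn²).
PairSet : ℕ → ℕ → ℕ → Set
PairSet t m n =
  0 < m × 0 < n × Coprime m n ×
  IsSquare (m * m + t * (n * n)) ×
  (∃ λ k → k * k + t * (n * n) ≡ m * m)

-- Write b = a + d.  For a Pythagorean triple (a + b)² = c² + 2ab and d² + 2ab = c², and
-- 2ab = t n² with n = 2s exactly when ab/2 = t s²; so (c, n) is the pair, with square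
-- roots a + b and d.  Conversely, j² = m² + T and k² + T = m² give j² − k² = 2T, which
-- forces j = k + 2q with 2q(q + k) = T, and (q, q + k, m) is a Pythagorean triple with
-- 2ab = T.  Squarefreeness of t and gcd(m, n) = 1 make it primitive: a common factor d
-- of the legs has d² ∣ t n² with d coprime to n.  Likewise 4 ∣ t n² forces n to be even.
module Submission where

open import Defs
open import Data.Nat using (ℕ; zero; suc; _+_; _*_; _<_; _≤_; _>_; _/_; z≤n; s≤s; >-nonZero; nonTrivial⇒≢1)
open import Data.Nat.Properties
open import Data.Nat.Divisibility
open import Data.Nat.Coprimality using (Coprime; coprime-divisor) renaming (sym to coprime-sym)
open import Data.Nat.Primality using (Prime; prime[2]; prime⇒nonTrivial; prime⇒irreducible; euclidsLemma)
open import Data.Nat.DivMod using (m*n/n≡m)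
open import Data.Nat.Tactic.RingSolver using (solve-∀)
open import Data.Product using (Σ; ∃; _×_; _,_)
open import Data.Sum using (inj₁; inj₂; reduce)
open import Relation.Nullary using (yes; no; contradiction)
open import Relation.Binary.PropositionalEquality

m*m≤n*n⇒m≤n : ∀ {m n} → m * m ≤ n * n → m ≤ n
m*m≤n*n⇒m≤n m*m≤n*n = ≮⇒≥ λ n<m → <⇒≱ (*-mono-< n<m n<m) m*m≤n*n

m*m<n*n⇒m<n : ∀ {m n} → m * m < n * n → m < n
m*m<n*n⇒m<n m*m<n*n = ≰⇒> λ n≤m → <⇒≱ m*m<n*n (*-mono-≤ n≤m n≤m)

m*m≡n*n⇒m≡n : ∀ {m n} → m * m ≡ n * n → m ≡ n
m*m≡n*n⇒m≡n eq = ≤-antisym (m*m≤n*n⇒m≤n (≤-reflexive eq)) (m*m≤n*n⇒m≤n (≤-reflexive (sym eq)))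

2∤⇒odd : ∀ {n} → 2 ∤ n → ∃ λ q → n ≡ 1 + q * 2
2∤⇒odd {zero}        2∤0 = contradiction (2 ∣0) 2∤0
2∤⇒odd {suc zero}    _   = 0 , refl
2∤⇒odd {suc (suc n)} 2∤n+2 with 2∤⇒odd {n} (λ 2∣n → 2∤n+2 (∣m∣n⇒∣m+n ∣-refl 2∣n))
... | q , n≡ = suc q , cong (2 +_) n≡

coprime-*ˡ : ∀ {m n o} → Coprime m o → Coprime n o → Coprime (m * n) o
coprime-*ˡ {m} m⊥o n⊥o {d} (d∣mn , d∣o) = n⊥o (coprime-divisor d⊥m d∣mn , d∣o)
  where
  d⊥m : Coprime d m
  d⊥m (e∣d , e∣m) = m⊥o (e∣m , ∣-trans e∣d d∣o)

coprime-square : ∀ {m n} → Coprime m n → Coprime (m * m) (n * n)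
coprime-square m⊥n = coprime-*ˡ m⊥nn m⊥nn
  where
  m⊥nn = coprime-sym (coprime-*ˡ (coprime-sym m⊥n) (coprime-sym m⊥n))

prime∧∤⇒coprime : ∀ {p n} → Prime p → p ∤ n → Coprime p n
prime∧∤⇒coprime pp p∤n (d∣p , d∣n) with prime⇒irreducible pp d∣p
... | inj₁ d≡1 = d≡1
... | inj₂ refl = contradiction d∣n p∤n

square-of-sum : ∀ a b → (a + b) * (a + b) ≡ a * a + b * b + 2 * (a * b)
square-of-sum = solve-∀

sum-of-squares-by-difference : ∀ a d → a * a + (a + d) * (a + d) ≡ d * d + 2 * (a * (a + d))
sum-of-squares-by-difference = solve-∀

pythagorean-difference : ∀ {a b c} → a ≤ b → a * a + b * b ≡ c * c →
                         ∃ λ d → a + d ≡ b × d * d + 2 * (a * b) ≡ c * c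
pythagorean-difference {a} a≤b pyth with m≤n⇒∃[o]m+o≡n a≤b
... | d , refl = d , refl , trans (sym (sum-of-squares-by-difference a d)) pyth

pythagorean-roots : ∀ {a b c j k} → a ≤ b → a * a + b * b ≡ c * c →
                    j * j ≡ c * c + 2 * (a * b) → k * k + 2 * (a * b) ≡ c * c →
                    (a + a + k ≡ j) × (b + b ≡ j + k)
pythagorean-roots {a} {b} {c} {j} {k} a≤b pyth j² k² with pythagorean-difference {c = c} a≤b pyth
... | d , refl , d²
  with m*m≡n*n⇒m≡n {j} {a + b} (trans j² (sym (trans (square-of-sum a b) (cong (_+ 2 * (a * b)) pyth))))
     | m*m≡n*n⇒m≡n {k} {d} (+-cancelʳ-≡ _ _ _ (trans k² (sym d²)))
... | refl | refl = +-assoc a a d , rearrange a d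
  where
  rearrange : ∀ a d → (a + d) + (a + d) ≡ (a + (a + d)) + d
  rearrange = solve-∀

odd-square : ∀ q → (1 + q * 2) * (1 + q * 2) ≡ 1 + (q * q + q) * 4
odd-square = solve-∀

-- Modulo 4 the left side is 2, while an even square is 0.
odd²+odd²≢square : ∀ {a b c} → 2 ∤ a → 2 ∤ b → a * a + b * b ≢ c * c
odd²+odd²≢square {c = c} 2∤a 2∤b pyth with 2∤⇒odd 2∤a | 2∤⇒odd 2∤b
... | p , refl | q , refl = >⇒∤ (s≤s (s≤s (s≤s z≤n))) 4∣2
  where
  X = p * p + p + (q * q + q)
  c²≡ : c * c ≡ X * 4 + 2
  c²≡ = begin
    c * c                                                 ≡⟨ sym pyth ⟩
    (1 + p * 2) * (1 + p * 2) + (1 + q * 2) * (1 + q * 2) ≡⟨ cong₂ _+_ (odd-square p) (odd-square q) ⟩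
    1 + (p * p + p) * 4 + (1 + (q * q + q) * 4)           ≡⟨ regroup (p * p + p) (q * q + q) ⟩
    X * 4 + 2                                             ∎
    where
    open ≡-Reasoning
    regroup : ∀ x y → 1 + x * 4 + (1 + y * 4) ≡ (x + y) * 4 + 2
    regroup = solve-∀
  2∣c : 2 ∣ c
  2∣c = reduce (euclidsLemma c c prime[2]
          (subst (2 ∣_) (sym c²≡) (∣m∣n⇒∣m+n (∣n⇒∣m*n X (divides 2 refl)) ∣-refl)))
  4∣2 : 4 ∣ 2
  4∣2 = ∣m+n∣m⇒∣n (subst (4 ∣_) c²≡ (*-pres-∣ 2∣c 2∣c)) (n∣m*n X)

pythagorean⇒2∣product : ∀ {a b c} → a * a + b * b ≡ c * c → 2 ∣ a * b
pythagorean⇒2∣product {a} {b} {c} pyth with 2 ∣? a | 2 ∣? b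
... | yes 2∣a | _       = ∣m⇒∣m*n b 2∣a
... | no _    | yes 2∣b = ∣n⇒∣m*n a 2∣b
... | no 2∤a  | no 2∤b  = contradiction pyth (odd²+odd²≢square {c = c} 2∤a 2∤b)

pythagorean⇒coprime-hypotenuse : ∀ {a b c} → Coprime a b → a * a + b * b ≡ c * c → Coprime b c
pythagorean⇒coprime-hypotenuse {a} {b} {c} a⊥b pyth {d} (d∣b , d∣c) = a⊥b (d∣a , d∣b)
  where
  d⊥a : Coprime d a
  d⊥a (e∣d , e∣a) = a⊥b (e∣a , ∣-trans e∣d d∣b)
  d∣a*a : d ∣ a * a
  d∣a*a = ∣m+n∣m⇒∣n (subst (d ∣_) (trans (sym pyth) (+-comm (a * a) (b * b))) (∣m⇒∣m*n c d∣c))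
                     (∣m⇒∣m*n b d∣b)
  d∣a : d ∣ a
  d∣a = coprime-divisor d⊥a d∣a*a

squarefree⇒>0 : ∀ {t} → Squarefree t → t > 0
squarefree⇒>0 {zero}  sf = contradiction (sf 2 ((2 * 2) ∣0)) λ ()
squarefree⇒>0 {suc t} _  = s≤s z≤n

squarefree⇒prime∣ : ∀ {t p n} → Squarefree t → Prime p → p * p ∣ t * (n * n) → p ∣ n
squarefree⇒prime∣ {t} {p} {n} sf pp pp∣tnn with p ∣? n
... | yes p∣n = p∣n
... | no p∤n  = contradiction (sf p pp∣t) (nonTrivial⇒≢1 {{prime⇒nonTrivial pp}})
  where
  pp∣t : p * p ∣ t
  pp∣t = coprime-divisor (coprime-square (prime∧∤⇒coprime pp p∤n))
                         (subst (p * p ∣_) (*-comm t (n * n)) pp∣tnn)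

squarefree⇒coprime-legs : ∀ {t m n a b} → Squarefree t → Coprime m n →
                          a * a + b * b ≡ m * m → a * b ∣ t * (n * n) → Coprime a b
squarefree⇒coprime-legs {t} {m} {n} sf m⊥n pyth ab∣tnn {d} (d∣a , d∣b) = sf d dd∣t
  where
  dd∣mm : d * d ∣ m * m
  dd∣mm = subst (d * d ∣_) pyth (∣m∣n⇒∣m+n (*-pres-∣ d∣a d∣a) (*-pres-∣ d∣b d∣b))
  dd⊥nn : Coprime (d * d) (n * n)
  dd⊥nn (e∣dd , e∣nn) = coprime-square m⊥n (∣-trans e∣dd dd∣mm , e∣nn)
  dd∣t : d * d ∣ t
  dd∣t = coprime-divisor dd⊥nn
           (subst (d * d ∣_) (*-comm t (n * n)) (∣-trans (*-pres-∣ d∣a d∣b) ab∣tnn))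

double-square : ∀ t s → t * (s * 2 * (s * 2)) ≡ 2 * (t * (s * s) * 2)
double-square = solve-∀

squarefreePart⇒double-area : ∀ {t x} → 2 ∣ x → SquarefreePart (x / 2) t →
                              ∃ λ n → 0 < n × t * (n * n) ≡ 2 * x
squarefreePart⇒double-area {t} (divides e refl) (_ , s , 0<s , e*2/2≡) =
  s * 2 , *-monoˡ-< 2 0<s , trans (double-square t s) (cong (λ y → 2 * (y * 2)) (sym e≡))
  where
  e≡ : e ≡ t * (s * s)
  e≡ = trans (sym (m*n/n≡m e 2)) e*2/2≡

double-area⇒squarefreePart : ∀ {t x n} → Squarefree t → 0 < n → 2 ∣ x →
                              t * (n * n) ≡ 2 * x → SquarefreePart (x / 2) t
double-area⇒squarefreePart {t} {n = n} sf 0<n (divides e refl) tnn≡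
  with squarefree⇒prime∣ {n = n} sf prime[2] (subst (2 * 2 ∣_) (sym tnn≡) (*-pres-∣ (∣-refl {2}) (n∣m*n e)))
... | divides s refl = sf , s , *-cancelʳ-< _ 0 s 0<n , trans (m*n/n≡m e 2) (sym tss≡e)
  where
  tss≡e : t * (s * s) ≡ e
  tss≡e = *-cancelʳ-≡ _ _ 2 (*-cancelˡ-≡ _ _ 2 (trans (sym (double-square t s)) tnn≡))

square-of-sum′ : ∀ k e → (k + e) * (k + e) ≡ k * k + e * (2 * k + e)
square-of-sum′ = solve-∀

even-gap : ∀ k e {T} → e * (2 * k + e) ≡ 2 * T → 2 ∣ e
even-gap k e {T} gap with euclidsLemma e (2 * k + e) prime[2] (subst (2 ∣_) (sym gap) (m∣m*n T))
... | inj₁ 2∣e      = 2∣e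
... | inj₂ 2∣2k+e   = ∣m+n∣m⇒∣n 2∣2k+e (m∣m*n k)

square-gap : ∀ {j k T} → j * j ≡ k * k + 2 * T → ∃ λ q → q + q + k ≡ j × 2 * (q * (q + k)) ≡ T
square-gap {j} {k} {T} j² with m≤n⇒∃[o]m+o≡n (m*m≤n*n⇒m≤n {k} {j} (subst (k * k ≤_) (sym j²) (m≤m+n _ _)))
... | e , refl with even-gap k e {T} (+-cancelˡ-≡ (k * k) _ _ (trans (sym (square-of-sum′ k e)) j²))
...   | divides q refl =
  q , reorder q k , *-cancelˡ-≡ _ _ 2 (+-cancelˡ-≡ (k * k) _ _ (trans (sym (expand q k)) j²))
  where
  reorder : ∀ q k → q + q + k ≡ k + q * 2
  reorder = solve-∀
  expand : ∀ q k → (k + q * 2) * (k + q * 2) ≡ k * k + 2 * (2 * (q * (q + k)))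
  expand = solve-∀

coprime-hypotenuse-root : ∀ {t a b c n} → Coprime a c → Coprime b c → 2 ∣ a * b →
                          t * (n * n) ≡ 2 * (a * b) → Coprime c n
coprime-hypotenuse-root {t} {a} {b} {c} {n} a⊥c b⊥c 2∣ab tnn≡ {e} (e∣c , e∣n) =
  coprime-*ˡ 2⊥c ab⊥c (subst (e ∣_) tnn≡ (∣n⇒∣m*n t (∣m⇒∣m*n n e∣n)) , e∣c)
  where
  ab⊥c : Coprime (a * b) c
  ab⊥c = coprime-*ˡ a⊥c b⊥c
  2⊥c : Coprime 2 c
  2⊥c = prime∧∤⇒coprime prime[2] λ 2∣c → contradiction (ab⊥c (2∣ab , 2∣c)) λ ()

triple⇒pair : ∀ {t a b c} → TripleSet t a b c → Σ ℕ λ n → t * (n * n) ≡ 2 * (a * b) × PairSet t c n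
triple⇒pair {t} {a} {b} {c} ((_ , _ , 0<c , _ , b⊥c , a⊥c , pyth) , a<b , _ , area)
  with pythagorean⇒2∣product {a} {b} {c} pyth
... | 2∣ab with squarefreePart⇒double-area 2∣ab area | pythagorean-difference {a} {b} {c} (<⇒≤ a<b) pyth
... | n , 0<n , tnn≡ | d , _ , d² =
  n , tnn≡ , 0<c , 0<n , coprime-hypotenuse-root {t} a⊥c b⊥c 2∣ab tnn≡ ,
  (a + b , trans (square-of-sum a b) (cong₂ _+_ pyth (sym tnn≡))) ,
  (d , trans (cong (d * d +_) tnn≡) d²)

pair⇒triple : ∀ {t m n j k} → Squarefree t → PairSet t m n →
              j * j ≡ m * m + t * (n * n) → k * k + t * (n * n) ≡ m * m →
              Σ ℕ λ a → Σ ℕ λ b →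
                (a + a + k ≡ j) × (b + b ≡ j + k) × TripleSet t a b m
                × ((n′ : ℕ) → t * (n′ * n′) ≡ 2 * (a * b) → n′ ≡ n)
pair⇒triple {t} {m} {n} {j} {k} sf (0<m , 0<n , m⊥n , _) j² k² with square-gap {j} {k} j²′
  where
  j²′ : j * j ≡ k * k + 2 * (t * (n * n))
  j²′ = trans j² (trans (cong (_+ t * (n * n)) (sym k²)) (regroup (k * k) (t * (n * n))))
    where
    regroup : ∀ x T → x + T + T ≡ x + 2 * T
    regroup = solve-∀
... | q , j≡ , area =
  q , q + k , j≡ , trans (regroup q k) (cong (_+ k) j≡) ,
  ((0<q , <-≤-trans 0<q (m≤m+n q k) , 0<m , a⊥b , b⊥m , a⊥m , pyth) , a<b , b<m ,
   double-area⇒squarefreePart sf 0<n 2∣ab (sym area)) ,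
  λ n′ tn′n′≡ → m*m≡n*n⇒m≡n (*-cancelˡ-≡ _ _ t {{>-nonZero 0<t}} (trans tn′n′≡ area))
  where
  regroup : ∀ q k → (q + k) + (q + k) ≡ q + q + k + k
  regroup = solve-∀
  0<t : 0 < t
  0<t = squarefree⇒>0 sf
  pyth : q * q + (q + k) * (q + k) ≡ m * m
  pyth = trans (sum-of-squares-by-difference q k) (trans (cong (k * k +_) area) k²)
  a⊥b : Coprime q (q + k)
  a⊥b = squarefree⇒coprime-legs sf m⊥n pyth (subst (q * (q + k) ∣_) area (n∣m*n 2))
  b⊥m : Coprime (q + k) m
  b⊥m = pythagorean⇒coprime-hypotenuse a⊥b pyth
  a⊥m : Coprime q m
  a⊥m = pythagorean⇒coprime-hypotenuse (coprime-sym a⊥b)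
          (trans (+-comm ((q + k) * (q + k)) (q * q)) pyth)
  2∣ab : 2 ∣ q * (q + k)
  2∣ab = pythagorean⇒2∣product {q} {q + k} {m} pyth
  0<q : 0 < q
  0<q = n≢0⇒n>0 λ { refl → n>0⇒n≢0 (*-mono-< 0<t (*-mono-< 0<n 0<n)) (sym area) }
  -- Equal legs would be coprime, hence both 1, and 1·1 is odd.
  a<b : q < q + k
  a<b = m<m+n q (n≢0⇒n>0 λ { refl → contradiction
          (∣1⇒≡1 (subst (λ x → 2 ∣ x * (x + 0)) (a⊥b (∣-refl , ∣-reflexive (sym (+-identityʳ q)))) 2∣ab))
          λ () })
  b<m : q + k < m
  b<m = m*m<n*n⇒m<n (subst ((q + k) * (q + k) <_) pyth (m<n+m _ (*-mono-< 0<q 0<q)))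

lemma2 : (t : ℕ) → Squarefree t →
    ((a b c : ℕ) → TripleSet t a b c →
      (Σ ℕ λ n → t * (n * n) ≡ 2 * (a * b) × PairSet t c n)
      × ((n j k : ℕ) → t * (n * n) ≡ 2 * (a * b) →
           j * j ≡ c * c + t * (n * n) → k * k + t * (n * n) ≡ c * c →
           (a + a + k ≡ j) × (b + b ≡ j + k)))
    ×
    ((m n : ℕ) → PairSet t m n → (j k : ℕ) →
      j * j ≡ m * m + t * (n * n) → k * k + t * (n * n) ≡ m * m →
      Σ ℕ λ a → Σ ℕ λ b →
        (a + a + k ≡ j) × (b + b ≡ j + k) × TripleSet t a b m
        × ((n′ : ℕ) → t * (n′ * n′) ≡ 2 * (a * b) → n′ ≡ n))
lemma2 t sf =
  (λ { a b c triple@((_ , _ , _ , _ , _ , _ , pyth) , a<b , _) →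
         triple⇒pair triple ,
         λ n j k tnn≡ j² k² → pythagorean-roots {c = c} (<⇒≤ a<b) pyth
                                (trans j² (cong (c * c +_) tnn≡)) (trans (cong (k * k +_) (sym tnn≡)) k²) }) ,
  λ m n pair j k → pair⇒triple sf pair
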